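{- Let $\mathfrak{A}\in\mathrm{REL}$ be a perfect algebra and let $a,b,c$ be atoms of $\mathfrak{A}$ with $a\le b;c$. Then: (1)(i) $st(a)\neq0\iff st(b)\neq0$, and (ii) if $st(a)\neq0$ and $st(b)\neq0$ then $\mathcal{S}a=\mathcal{S}b$; (2)(i) $end(a)\neq0\iff end(c)\neq0$, and (ii) if $end(a)\neq0$ and $end(c)\neq0$ then $\mathcal{E}a=\mathcal{E}c$; (3)(i) $end(b)\neq0\iff st(c)\neq0$, and (ii) if $end(b)\neq0$ and $st(c)\neq0$ then $\mathcal{E}b=\mathcal{S}c$.
   Context: $\mathrm{REL}$ is the class of algebras $\mathfrak{A}=\langle A,+,\cdot,-,0,1,;,\breve{\ },1'\rangle$ (binary $;$, unary converse $x\mapsto\breve{x}$, constant $1'$) satisfying: (Ax1) $\langle A,+,\cdot,-,0,1\rangle$ is a Boolean algebra; (Ax2) $(x\cdot\breve{y})\breve{}=\breve{x}\cdot y$; (Ax3) $(x+y);z=x;z+y;z$ and $x;(y+z)=x;y+x;z$; (Ax4) $1;0=0$ and $0;1=0$; (Ax5) $(\breve{x};y)\cdot z=(\breve{x};(y\cdot(\breve{\breve{x}};z)))\cdot z$ and $(x;\breve{y})\cdot z=((x\cdot(z;\breve{\breve{y}}));\breve{y})\cdot z$; (Ax6) $1';x\le x$ and $x;1'\le x$; (Ax7) $1';1'=1'$; (Ax8) $(-(\breve{1});-(\breve{1}))\cdot 1'=0$; (Ax9) $((x\cdot1');y);z=(x\cdot1');(y;z)$, $(x;(y\cdot1'));z=x;((y\cdot1');z)$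 and $(x;y);(z\cdot1')=x;(y;(z\cdot1'))$. An algebra $\mathfrak{A}\in\mathrm{REL}$ is perfect if it is complete and atomic and its converse and composition operations are completely additive. For an atom $a$, $st(a)=1';a$ and $end(a)=a;1'$. In a perfect $\mathfrak{A}\in\mathrm{REL}$: if $st(a)\neq0$, $\mathcal{S}a$ denotes the unique atom $a^-\le1'$ with $a^-;a=a$; if $end(a)\neq0$, $\mathcal{E}a$ denotes the unique atom $a^-\le1'$ with $a;a^-=a$ (these exist and are unique). -}

module Defs where

open import Level using (Level; suc)
open import Data.Product using (Σ; ∃; _×_; _,_)
open import Data.Sum using (_⊎_)
open import Relation.Binary.PropositionalEquality using (_≡_)
open import Relation.Nullary using (¬_)
open import Algebra.Lattice.Structures using (IsBooleanAlgebra)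

-- An algebra 𝔄 = ⟨A,+,·,-,0,1,;,˘,1'⟩ in the class REL (axioms Ax1–Ax9),
-- with equality on the carrier taken to be propositional equality.
record REL (ℓ : Level) : Set (suc ℓ) where
  infixl 6 _+_
  infixl 7 _·_
  infixl 8 _⨾_
  infix 9 _˘
  field
    A    : Set ℓ
    _+_  : A → A → A
    _·_  : A → A → A
    -_   : A → A
    𝟘    : A
    𝟙    : A
    _⨾_  : A → A → A
    _˘   : A → A
    𝟙'   : A
    isBooleanAlgebra : IsBooleanAlgebra _≡_ _+_ _·_ -_ 𝟙 𝟘

  _≤_ : A → A → Set ℓ
  x ≤ y = x + y ≡ y

  field
    ax2 : ∀ x y → (x · (y ˘)) ˘ ≡ (x ˘) · y
    ax3ˡ : ∀ x y z → (x + y) ⨾ z ≡ x ⨾ z + y ⨾ z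
    ax3ʳ : ∀ x y z → x ⨾ (y + z) ≡ x ⨾ y + x ⨾ z
    ax4ˡ : 𝟙 ⨾ 𝟘 ≡ 𝟘
    ax4ʳ : 𝟘 ⨾ 𝟙 ≡ 𝟘
    ax5ˡ : ∀ x y z → ((x ˘) ⨾ y) · z ≡ ((x ˘) ⨾ (y · (((x ˘) ˘) ⨾ z))) · z
    ax5ʳ : ∀ x y z → (x ⨾ (y ˘)) · z ≡ ((x · (z ⨾ ((y ˘) ˘))) ⨾ (y ˘)) · z
    ax6ˡ : ∀ x → (𝟙' ⨾ x) ≤ x
    ax6ʳ : ∀ x → (x ⨾ 𝟙') ≤ x
    ax7 : 𝟙' ⨾ 𝟙' ≡ 𝟙'
    ax8 : ((- (𝟙 ˘)) ⨾ (- (𝟙 ˘))) · 𝟙' ≡ 𝟘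
    ax9₁ : ∀ x y z → ((x · 𝟙') ⨾ y) ⨾ z ≡ (x · 𝟙') ⨾ (y ⨾ z)
    ax9₂ : ∀ x y z → (x ⨾ (y · 𝟙')) ⨾ z ≡ x ⨾ ((y · 𝟙') ⨾ z)
    ax9₃ : ∀ x y z → (x ⨾ y) ⨾ (z · 𝟙') ≡ x ⨾ (y ⨾ (z · 𝟙'))

  IsSup : (A → Set ℓ) → A → Set ℓ
  IsSup P s = (∀ x → P x → x ≤ s) × (∀ u → (∀ x → P x → x ≤ u) → s ≤ u)

  IsAtom : A → Set ℓ
  IsAtom x = ¬ (x ≡ 𝟘) × (∀ y → y ≤ x → (y ≡ 𝟘) ⊎ (y ≡ x))

  st : A → A
  st a = 𝟙' ⨾ a

  end : A → A
  end a = a ⨾ 𝟙'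

  Is𝒮 : A → A → Set ℓ
  Is𝒮 a e = IsAtom e × e ≤ 𝟙' × e ⨾ a ≡ a

  Isℰ : A → A → Set ℓ
  Isℰ a e = IsAtom e × e ≤ 𝟙' × a ⨾ e ≡ a

  Image : (A → A) → (A → Set ℓ) → A → Set ℓ
  Image f P y = Σ A (λ x → P x × y ≡ f x)

  Complete : Set (suc ℓ)
  Complete = ∀ (P : A → Set ℓ) → Σ A (IsSup P)

  Atomic : Set ℓ
  Atomic = ∀ x → ¬ (x ≡ 𝟘) → Σ A (λ a → IsAtom a × a ≤ x)

  CompletelyAdditive : Set (suc ℓ)
  CompletelyAdditive =
    (∀ (P : A → Set ℓ) s → IsSup P s → IsSup (Image _˘ P) (s ˘)) ×
    (∀ (P : A → Set ℓ) s z → IsSup P s → IsSup (Image (λ x → x ⨾ z) P) (s ⨾ z)) ×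
    (∀ (P : A → Set ℓ) s z → IsSup P s → IsSup (Image (λ x → z ⨾ x) P) (z ⨾ s))

  Perfect : Set (suc ℓ)
  Perfect = Complete × Atomic × CompletelyAdditive

open REL public

Same𝒮𝒮 : ∀ {ℓ} (𝔄 : REL ℓ) → A 𝔄 → A 𝔄 → Set ℓ
Same𝒮𝒮 𝔄 a b = Σ (A 𝔄) (λ e → Is𝒮 𝔄 a e × Is𝒮 𝔄 b e)
               × (∀ e e' → Is𝒮 𝔄 a e → Is𝒮 𝔄 b e' → e ≡ e')

Sameℰℰ : ∀ {ℓ} (𝔄 : REL ℓ) → A 𝔄 → A 𝔄 → Set ℓ
Sameℰℰ 𝔄 a b = Σ (A 𝔄) (λ e → Isℰ 𝔄 a e × Isℰ 𝔄 b e)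
               × (∀ e e' → Isℰ 𝔄 a e → Isℰ 𝔄 b e' → e ≡ e')

Sameℰ𝒮 : ∀ {ℓ} (𝔄 : REL ℓ) → A 𝔄 → A 𝔄 → Set ℓ
Sameℰ𝒮 𝔄 a b = Σ (A 𝔄) (λ e → Isℰ 𝔄 a e × Is𝒮 𝔄 b e)
               × (∀ e e' → Isℰ 𝔄 a e → Is𝒮 𝔄 b e' → e ≡ e')

-- Two distinct atoms e, e' below 1' are disjoint, so e ; e' ≤ e · e' = 0 and every composite
-- passing through both vanishes; as a ≠ 0, the subidentities attached to a, b, c in the three
-- parts must coincide. 𝒮x exists by completeness: the join s of all subidentities f with
-- f ; x = 0 still annihilates x by complete additivity, so 1' · -s ≠ 0 and any atom below it
-- is 𝒮x. For the equivalences, st x = 0 makes x disjoint from every 1' ; y, by the modular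
-- law Ax5 once 1'˘ = 1' is known. Part (2) is part (1) in the opposite algebra, where x ; y
-- is read as y ; x.
module Submission where

open import Defs using (REL; Perfect; Same𝒮𝒮; Sameℰℰ; Sameℰ𝒮)
open import Level using (Level)
open import Data.Product using (Σ; _×_; _,_; proj₁; proj₂)
open import Data.Sum using (_⊎_; inj₁; inj₂)
open import Data.Empty using (⊥-elim)
open import Function.Base using (_∘′_)
open import Function.Bundles using (_⇔_; mk⇔)
open import Relation.Binary.Bundles using (Poset)
open import Relation.Binary.PropositionalEquality
  using (_≡_; refl; sym; trans; cong; cong₂; subst; isEquivalence; module ≡-Reasoning)
open import Relation.Nullary using (¬_)
open import Algebra.Lattice.Bundles using (BooleanAlgebra)
import Algebra.Lattice.Properties.BooleanAlgebra as BooleanAlgebraProperties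
import Relation.Binary.Reasoning.PartialOrder as PartialOrderReasoning

common-witness : ∀ {a p q} {X : Set a} {P : X → Set p} {Q : X → Set q} →
  Σ X P → Σ X Q → (∀ x y → P x → Q y → x ≡ y) →
  Σ X (λ x → P x × Q x) × (∀ x y → P x → Q y → x ≡ y)
common-witness {Q = Q} (x , px) (y , qy) unique =
  (x , px , subst Q (sym (unique x y px qy)) qy) , unique

_ᵒᵖ : ∀ {ℓ} → REL ℓ → REL ℓ
𝔄 ᵒᵖ = record
  { A = A ; _+_ = _+_ ; _·_ = _·_ ; -_ = -_ ; 𝟘 = 𝟘 ; 𝟙 = 𝟙
  ; _⨾_ = λ x y → y ⨾ x ; _˘ = _˘ ; 𝟙' = 𝟙'
  ; isBooleanAlgebra = isBooleanAlgebra
  ; ax2 = ax2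
  ; ax3ˡ = λ x y z → ax3ʳ z x y
  ; ax3ʳ = λ x y z → ax3ˡ y z x
  ; ax4ˡ = ax4ʳ
  ; ax4ʳ = ax4ˡ
  ; ax5ˡ = λ x y z → ax5ʳ y x z
  ; ax5ʳ = λ x y z → ax5ˡ y x z
  ; ax6ˡ = ax6ʳ
  ; ax6ʳ = ax6ˡ
  ; ax7 = ax7
  ; ax8 = ax8
  ; ax9₁ = λ x y z → sym (ax9₃ z y x)
  ; ax9₂ = λ x y z → sym (ax9₂ z y x)
  ; ax9₃ = λ x y z → sym (ax9₁ z y x)
  }
  where open REL 𝔄

perfect-ᵒᵖ : ∀ {ℓ} (𝔄 : REL ℓ) → Perfect 𝔄 → Perfect (𝔄 ᵒᵖ)
perfect-ᵒᵖ _ (complete , atomic , ˘-sup , ⨾-supˡ , ⨾-supʳ) =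
  complete , atomic , ˘-sup , ⨾-supʳ , ⨾-supˡ

module Properties {ℓ} (𝔄 : REL ℓ) where
  open REL 𝔄 renaming (_≤_ to infix 4 _≤_)

  booleanAlgebra : BooleanAlgebra ℓ ℓ
  booleanAlgebra = record { isBooleanAlgebra = isBooleanAlgebra }

  open BooleanAlgebra booleanAlgebra
    using (∨-comm; ∨-assoc; ∧-comm; ∧-assoc; ∨-absorbs-∧; ∧-absorbs-∨;
           ∧-distribˡ-∨; ∨-complementʳ; ∧-complementʳ)
  open BooleanAlgebraProperties booleanAlgebra
    using (∨-idem; ∧-idem; ∨-identityˡ; ∨-identityʳ; ∧-identityˡ; ∧-identityʳ; ∨-zeroʳ)

  ≤⇒·≡ : ∀ {x y} → x ≤ y → x · y ≡ x
  ≤⇒·≡ {x} {y} x≤y = trans (cong (x ·_) (sym x≤y)) (∧-absorbs-∨ x y)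

  ·≡⇒≤ : ∀ {x y} → x · y ≡ x → x ≤ y
  ·≡⇒≤ {x} {y} x·y≡x = begin
    x + y     ≡⟨ cong (_+ y) (sym x·y≡x) ⟩
    x · y + y ≡⟨ ∨-comm (x · y) y ⟩
    y + x · y ≡⟨ cong (y +_) (∧-comm x y) ⟩
    y + y · x ≡⟨ ∨-absorbs-∧ y x ⟩
    y         ∎
    where open ≡-Reasoning

  ≤-refl : ∀ {x} → x ≤ x
  ≤-refl {x} = ∨-idem x

  ≤-trans : ∀ {x y z} → x ≤ y → y ≤ z → x ≤ z
  ≤-trans {x} {y} {z} x≤y y≤z = begin
    x + z       ≡⟨ cong (x +_) (sym y≤z) ⟩
    x + (y + z) ≡⟨ sym (∨-assoc x y z) ⟩
    x + y + z   ≡⟨ cong (_+ z) x≤y ⟩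
    y + z       ≡⟨ y≤z ⟩
    z           ∎
    where open ≡-Reasoning

  ≤-antisym : ∀ {x y} → x ≤ y → y ≤ x → x ≡ y
  ≤-antisym {x} {y} x≤y y≤x = trans (sym y≤x) (trans (∨-comm y x) x≤y)

  poset : Poset ℓ ℓ ℓ
  poset = record
    { isPartialOrder = record
      { isPreorder = record
        { isEquivalence = isEquivalence
        ; reflexive = λ { refl → ≤-refl }
        ; trans = ≤-trans
        }
      ; antisym = ≤-antisym
      }
    }

  module ≤-Reasoning = PartialOrderReasoning poset

  x≤x+y : ∀ x y → x ≤ x + y
  x≤x+y x y = trans (sym (∨-assoc x x y)) (cong (_+ y) (∨-idem x))

  y≤x+y : ∀ x y → y ≤ x + y
  y≤x+y x y = subst (y ≤_) (∨-comm y x) (x≤x+y y x)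

  +-least : ∀ {x y z} → x ≤ z → y ≤ z → x + y ≤ z
  +-least {x} {y} {z} x≤z y≤z = trans (∨-assoc x y z) (trans (cong (x +_) y≤z) x≤z)

  x·y≤x : ∀ x y → x · y ≤ x
  x·y≤x x y = ·≡⇒≤ (trans (∧-comm (x · y) x)
    (trans (sym (∧-assoc x x y)) (cong (_· y) (∧-idem x))))

  x·y≤y : ∀ x y → x · y ≤ y
  x·y≤y x y = subst (_≤ y) (∧-comm y x) (x·y≤x y x)

  ·-greatest : ∀ {x y z} → z ≤ x → z ≤ y → z ≤ x · y
  ·-greatest {x} {y} {z} z≤x z≤y =
    ·≡⇒≤ (trans (sym (∧-assoc z x y)) (trans (cong (_· y) (≤⇒·≡ z≤x)) (≤⇒·≡ z≤y)))

  x≤𝟘⇒x≡𝟘 : ∀ {x} → x ≤ 𝟘 → x ≡ 𝟘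
  x≤𝟘⇒x≡𝟘 {x} x≤𝟘 = trans (sym (∨-identityʳ x)) x≤𝟘

  ≤+disjoint⇒≤ : ∀ {x y z} → x ≤ y + z → x · z ≡ 𝟘 → x ≤ y
  ≤+disjoint⇒≤ {x} {y} {z} x≤y+z x·z≡𝟘 = ·≡⇒≤ (begin
    x · y         ≡⟨ sym (∨-identityʳ (x · y)) ⟩
    x · y + 𝟘     ≡⟨ cong (x · y +_) (sym x·z≡𝟘) ⟩
    x · y + x · z ≡⟨ sym (∧-distribˡ-∨ x y z) ⟩
    x · (y + z)   ≡⟨ ≤⇒·≡ x≤y+z ⟩
    x             ∎)
    where open ≡-Reasoning

  x·-y≡𝟘⇒x≤y : ∀ {x y} → x · - y ≡ 𝟘 → x ≤ y
  x·-y≡𝟘⇒x≤y {x} {y} =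
    ≤+disjoint⇒≤ (subst (x ≤_) (sym (∨-complementʳ y)) (∨-zeroʳ x))

  x≤y∧x≤-y⇒x≡𝟘 : ∀ {x y} → x ≤ y → x ≤ (- y) → x ≡ 𝟘
  x≤y∧x≤-y⇒x≡𝟘 {x} {y} x≤y x≤-y =
    x≤𝟘⇒x≡𝟘 (subst (x ≤_) (∧-complementʳ y) (·-greatest x≤y x≤-y))

  ⨾-monoˡ-≤ : ∀ {x y} z → x ≤ y → x ⨾ z ≤ y ⨾ z
  ⨾-monoˡ-≤ {x} {y} z x≤y = trans (sym (ax3ˡ x y z)) (cong (_⨾ z) x≤y)

  ⨾-monoʳ-≤ : ∀ {x y} z → x ≤ y → z ⨾ x ≤ z ⨾ y
  ⨾-monoʳ-≤ {x} {y} z x≤y = trans (sym (ax3ʳ z x y)) (cong (z ⨾_) x≤y)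

  ⨾-mono-≤ : ∀ {x x' y y'} → x ≤ x' → y ≤ y' → x ⨾ y ≤ x' ⨾ y'
  ⨾-mono-≤ {x' = x'} {y} x≤x' y≤y' = ≤-trans (⨾-monoˡ-≤ y x≤x') (⨾-monoʳ-≤ x' y≤y')

  ⨾-zeroʳ : ∀ x → x ⨾ 𝟘 ≡ 𝟘
  ⨾-zeroʳ x = x≤𝟘⇒x≡𝟘 (subst (x ⨾ 𝟘 ≤_) ax4ˡ (⨾-monoˡ-≤ 𝟘 (∨-zeroʳ x)))

  ⨾-zeroˡ : ∀ x → 𝟘 ⨾ x ≡ 𝟘
  ⨾-zeroˡ x = x≤𝟘⇒x≡𝟘 (subst (𝟘 ⨾ x ≤_) ax4ʳ (⨾-monoʳ-≤ 𝟘 (∨-zeroʳ x)))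

  subid⨾≤ : ∀ {d} → d ≤ 𝟙' → ∀ x → d ⨾ x ≤ x
  subid⨾≤ d≤𝟙' x = ≤-trans (⨾-monoˡ-≤ x d≤𝟙') (ax6ˡ x)

  ⨾subid≤ : ∀ {d} → d ≤ 𝟙' → ∀ x → x ⨾ d ≤ x
  ⨾subid≤ d≤𝟙' x = ≤-trans (⨾-monoʳ-≤ x d≤𝟙') (ax6ʳ x)

  subid⨾-assoc : ∀ {d} → d ≤ 𝟙' → ∀ y z → (d ⨾ y) ⨾ z ≡ d ⨾ (y ⨾ z)
  subid⨾-assoc {d} d≤𝟙' y z =
    subst (λ e → (e ⨾ y) ⨾ z ≡ e ⨾ (y ⨾ z)) (≤⇒·≡ d≤𝟙') (ax9₁ d y z)

  ⨾subid⨾-assoc : ∀ {d} → d ≤ 𝟙' → ∀ x z → (x ⨾ d) ⨾ z ≡ x ⨾ (d ⨾ z)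
  ⨾subid⨾-assoc {d} d≤𝟙' x z =
    subst (λ e → (x ⨾ e) ⨾ z ≡ x ⨾ (e ⨾ z)) (≤⇒·≡ d≤𝟙') (ax9₂ x d z)

  subid⨾subid≤· : ∀ {u v} → u ≤ 𝟙' → v ≤ 𝟙' → u ⨾ v ≤ u · v
  subid⨾subid≤· {u} {v} u≤𝟙' v≤𝟙' = ·-greatest (⨾subid≤ v≤𝟙' u) (subid⨾≤ u≤𝟙' v)

  disjoint-subid⨾≡𝟘 : ∀ {u v} → u ≤ 𝟙' → v ≤ 𝟙' → u · v ≡ 𝟘 → u ⨾ v ≡ 𝟘
  disjoint-subid⨾≡𝟘 {u} {v} u≤𝟙' v≤𝟙' u·v≡𝟘 =
    x≤𝟘⇒x≡𝟘 (subst (u ⨾ v ≤_) u·v≡𝟘 (subid⨾subid≤· u≤𝟙' v≤𝟙'))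

  -- Split 1' = d + d' with d' = 1' · -d; in (d + d') ; (d + d') the cross terms vanish.
  subid≤⨾self : ∀ {d} → d ≤ 𝟙' → d ≤ d ⨾ d
  subid≤⨾self {d} d≤𝟙' = ≤+disjoint⇒≤ d≤d⨾d+d' d·d'≡𝟘
    where
      open ≤-Reasoning
      d' = 𝟙' · - d
      d'≤𝟙' = x·y≤x 𝟙' (- d)
      d·d'≡𝟘 : d · d' ≡ 𝟘
      d·d'≡𝟘 = x≤y∧x≤-y⇒x≡𝟘 (x·y≤x d d') (≤-trans (x·y≤y d d') (x·y≤y 𝟙' (- d)))
      d'·d≡𝟘 : d' · d ≡ 𝟘
      d'·d≡𝟘 = trans (∧-comm d' d) d·d'≡𝟘
      𝟙'≤d+d' : 𝟙' ≤ d + d'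
      𝟙'≤d+d' = begin
        𝟙'                ≡⟨ sym (∧-identityʳ 𝟙') ⟩
        𝟙' · 𝟙            ≡⟨ cong (𝟙' ·_) (sym (∨-complementʳ d)) ⟩
        𝟙' · (d + - d)    ≡⟨ ∧-distribˡ-∨ 𝟙' d (- d) ⟩
        𝟙' · d + d'       ≤⟨ +-least (≤-trans (x·y≤y 𝟙' d) (x≤x+y d d')) (y≤x+y d d') ⟩
        d + d'            ∎
      d≤d⨾d+d' : d ≤ d ⨾ d + d'
      d≤d⨾d+d' = begin
        d                                     ≤⟨ d≤𝟙' ⟩
        𝟙'                                    ≡⟨ sym ax7 ⟩
        𝟙' ⨾ 𝟙'                               ≤⟨ ⨾-mono-≤ 𝟙'≤d+d' 𝟙'≤d+d' ⟩
        (d + d') ⨾ (d + d')                   ≡⟨ trans (ax3ˡ d d' (d + d'))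
                                                   (cong₂ _+_ (ax3ʳ d d d') (ax3ʳ d' d d')) ⟩
        (d ⨾ d + d ⨾ d') + (d' ⨾ d + d' ⨾ d') ≡⟨ cong₂ (λ p q → (d ⨾ d + p) + (q + d' ⨾ d'))
                                                   (disjoint-subid⨾≡𝟘 d≤𝟙' d'≤𝟙' d·d'≡𝟘)
                                                   (disjoint-subid⨾≡𝟘 d'≤𝟙' d≤𝟙' d'·d≡𝟘) ⟩
        (d ⨾ d + 𝟘) + (𝟘 + d' ⨾ d')           ≡⟨ cong₂ _+_ (∨-identityʳ (d ⨾ d)) (∨-identityˡ (d' ⨾ d')) ⟩
        d ⨾ d + d' ⨾ d'                       ≤⟨ +-least (x≤x+y (d ⨾ d) d')
                                                   (≤-trans (⨾subid≤ d'≤𝟙' d') (y≤x+y (d ⨾ d) d')) ⟩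
        d ⨾ d + d'                            ∎

  𝟙'≤𝟙˘ : 𝟙' ≤ 𝟙 ˘
  𝟙'≤𝟙˘ = x·-y≡𝟘⇒x≤y (x≤𝟘⇒x≡𝟘 (begin
    p                                ≤⟨ ·-greatest (≤-trans (subid≤⨾self p≤𝟙') (⨾-mono-≤ p≤-𝟙˘ p≤-𝟙˘)) p≤𝟙' ⟩
    ((- (𝟙 ˘)) ⨾ (- (𝟙 ˘))) · 𝟙'     ≡⟨ ax8 ⟩
    𝟘                                ∎))
    where
      open ≤-Reasoning
      p = 𝟙' · - (𝟙 ˘)
      p≤𝟙' = x·y≤x 𝟙' (- (𝟙 ˘))
      p≤-𝟙˘ = x·y≤y 𝟙' (- (𝟙 ˘))

  𝟙'˘˘≡𝟙' : (𝟙' ˘) ˘ ≡ 𝟙'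
  𝟙'˘˘≡𝟙' = begin
    (𝟙' ˘) ˘       ≡⟨ cong _˘ (sym (∧-identityˡ (𝟙' ˘))) ⟩
    (𝟙 · 𝟙' ˘) ˘   ≡⟨ ax2 𝟙 𝟙' ⟩
    𝟙 ˘ · 𝟙'       ≡⟨ ∧-comm (𝟙 ˘) 𝟙' ⟩
    𝟙' · 𝟙 ˘       ≡⟨ ≤⇒·≡ 𝟙'≤𝟙˘ ⟩
    𝟙'             ∎
    where open ≡-Reasoning

  atom-·≢𝟘⇒≡ : ∀ {e e'} → IsAtom e → IsAtom e' → ¬ e · e' ≡ 𝟘 → e ≡ e'
  atom-·≢𝟘⇒≡ {e} {e'} (e≢𝟘 , below-e) (_ , below-e') e·e'≢𝟘
    with below-e (e · e') (x·y≤x e e')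
  ... | inj₁ e·e'≡𝟘 = ⊥-elim (e·e'≢𝟘 e·e'≡𝟘)
  ... | inj₂ e·e'≡e with below-e' e (·≡⇒≤ e·e'≡e)
  ...   | inj₁ e≡𝟘 = ⊥-elim (e≢𝟘 e≡𝟘)
  ...   | inj₂ e≡e' = e≡e'

  st-atom : ∀ {x} → IsAtom x → ¬ st x ≡ 𝟘 → st x ≡ x
  st-atom {x} (_ , below-x) st≢𝟘 with below-x (st x) (ax6ˡ x)
  ... | inj₁ st≡𝟘 = ⊥-elim (st≢𝟘 st≡𝟘)
  ... | inj₂ st≡x = st≡x

module PerfectProperties {ℓ} (𝔄 : REL ℓ) (perfect : Perfect 𝔄) where
  open REL 𝔄 renaming (_≤_ to infix 4 _≤_)
  open Properties 𝔄
  open BooleanAlgebra booleanAlgebra using (∧-comm)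
  open BooleanAlgebraProperties booleanAlgebra using (∧-identityˡ; ∧-zeroˡ; ∧-zeroʳ; ∨-zeroʳ)

  private
    complete = proj₁ perfect
    atomic = proj₁ (proj₂ perfect)
    ˘-sup = proj₁ (proj₂ (proj₂ perfect))
    ⨾-supˡ = proj₁ (proj₂ (proj₂ (proj₂ perfect)))

  -- y is the join of {x, y}, so y ˘ is the join of {x ˘, y ˘}.
  ˘-mono-≤ : ∀ {x y} → x ≤ y → x ˘ ≤ y ˘
  ˘-mono-≤ {x} {y} x≤y = proj₁ (˘-sup x-or-y y y-sup) (x ˘) (x , inj₁ refl , refl)
    where
      x-or-y : A → Set ℓ
      x-or-y z = (z ≡ x) ⊎ (z ≡ y)
      y-sup : IsSup x-or-y y
      y-sup = (λ { _ (inj₁ refl) → x≤y ; _ (inj₂ refl) → ≤-refl }) , (λ _ ub → ub y (inj₂ refl))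

  -- 1' ≤ 1'˘ by Ax5 at x = 1'˘; conversing gives 1'˘ ≤ 1'˘˘ = 1'.
  𝟙'˘≡𝟙' : 𝟙' ˘ ≡ 𝟙'
  𝟙'˘≡𝟙' = ≤-antisym (subst (𝟙' ˘ ≤_) 𝟙'˘˘≡𝟙' (˘-mono-≤ 𝟙'≤𝟙'˘)) 𝟙'≤𝟙'˘
    where
      open ≤-Reasoning
      w = 𝟙' ˘
      modular : (𝟙' ⨾ 𝟙) · 𝟙' ≡ (𝟙' ⨾ (𝟙 · (w ⨾ 𝟙'))) · 𝟙'
      modular = subst (λ v → (v ⨾ 𝟙) · 𝟙' ≡ (v ⨾ (𝟙 · (v ˘ ⨾ 𝟙'))) · 𝟙') 𝟙'˘˘≡𝟙' (ax5ˡ w 𝟙 𝟙')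
      𝟙'≤𝟙'˘ : 𝟙' ≤ w
      𝟙'≤𝟙'˘ = begin
        𝟙'                             ≤⟨ ·-greatest (subst (_≤ 𝟙' ⨾ 𝟙) ax7 (⨾-monoʳ-≤ 𝟙' (∨-zeroʳ 𝟙'))) ≤-refl ⟩
        (𝟙' ⨾ 𝟙) · 𝟙'                  ≡⟨ modular ⟩
        (𝟙' ⨾ (𝟙 · (w ⨾ 𝟙'))) · 𝟙'     ≤⟨ x·y≤x _ 𝟙' ⟩
        𝟙' ⨾ (𝟙 · (w ⨾ 𝟙'))            ≤⟨ ax6ˡ _ ⟩
        𝟙 · (w ⨾ 𝟙')                   ≡⟨ ∧-identityˡ (w ⨾ 𝟙') ⟩
        w ⨾ 𝟙'                         ≤⟨ ax6ʳ w ⟩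
        w                              ∎

  st≡𝟘⇒≤𝟙'⨾⇒≡𝟘 : ∀ {x y} → st x ≡ 𝟘 → x ≤ 𝟙' ⨾ y → x ≡ 𝟘
  st≡𝟘⇒≤𝟙'⨾⇒≡𝟘 {x} {y} st≡𝟘 x≤𝟙'⨾y = begin
    x                              ≡⟨ sym (≤⇒·≡ x≤𝟙'⨾y) ⟩
    x · (𝟙' ⨾ y)                   ≡⟨ ∧-comm x (𝟙' ⨾ y) ⟩
    (𝟙' ⨾ y) · x                   ≡⟨ modular ⟩
    (𝟙' ⨾ (y · st x)) · x          ≡⟨ cong (λ z → (𝟙' ⨾ (y · z)) · x) st≡𝟘 ⟩
    (𝟙' ⨾ (y · 𝟘)) · x             ≡⟨ cong (λ z → (𝟙' ⨾ z) · x) (∧-zeroʳ y) ⟩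
    (𝟙' ⨾ 𝟘) · x                   ≡⟨ cong (_· x) (⨾-zeroʳ 𝟙') ⟩
    𝟘 · x                          ≡⟨ ∧-zeroˡ x ⟩
    𝟘                              ∎
    where
      open ≡-Reasoning
      modular : (𝟙' ⨾ y) · x ≡ (𝟙' ⨾ (y · (𝟙' ⨾ x))) · x
      modular = subst (λ v → (v ⨾ y) · x ≡ (v ⨾ (y · (𝟙' ⨾ x))) · x) 𝟙'˘≡𝟙'
        (trans (ax5ˡ 𝟙' y x) (cong (λ v → ((𝟙' ˘) ⨾ (y · (v ⨾ x))) · x) 𝟙'˘˘≡𝟙'))

  𝒮-exists : ∀ {x} → IsAtom x → ¬ st x ≡ 𝟘 → Σ A (Is𝒮 x)
  𝒮-exists {x} x-atom st≢𝟘 = e , e-atom , e≤𝟙' , e⨾x≡x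
    where
      open ≤-Reasoning
      annihilates : A → Set ℓ
      annihilates f = f ≤ 𝟙' × f ⨾ x ≡ 𝟘
      s = proj₁ (complete annihilates)
      s-sup = proj₂ (complete annihilates)
      s⨾x≡𝟘 : s ⨾ x ≡ 𝟘
      s⨾x≡𝟘 = x≤𝟘⇒x≡𝟘 (proj₂ (⨾-supˡ annihilates s x s-sup) 𝟘
        λ { _ (f , (_ , f⨾x≡𝟘) , refl) → subst (_≤ 𝟘) (sym f⨾x≡𝟘) ≤-refl })
      𝟙'·-s≢𝟘 : ¬ 𝟙' · - s ≡ 𝟘
      𝟙'·-s≢𝟘 𝟙'·-s≡𝟘 = proj₁ x-atom (x≤𝟘⇒x≡𝟘 (begin
        x        ≡⟨ sym (st-atom x-atom st≢𝟘) ⟩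
        𝟙' ⨾ x   ≤⟨ ⨾-monoˡ-≤ x (x·-y≡𝟘⇒x≤y 𝟙'·-s≡𝟘) ⟩
        s ⨾ x    ≡⟨ s⨾x≡𝟘 ⟩
        𝟘        ∎))
      e-below = atomic (𝟙' · - s) 𝟙'·-s≢𝟘
      e = proj₁ e-below
      e-atom = proj₁ (proj₂ e-below)
      e≤𝟙'·-s = proj₂ (proj₂ e-below)
      e≤𝟙' = ≤-trans e≤𝟙'·-s (x·y≤x 𝟙' (- s))
      e⨾x≡x : e ⨾ x ≡ x
      e⨾x≡x with proj₂ x-atom (e ⨾ x) (subid⨾≤ e≤𝟙' x)
      ... | inj₂ e⨾x≡x = e⨾x≡x
      ... | inj₁ e⨾x≡𝟘 = ⊥-elim (proj₁ e-atom (x≤y∧x≤-y⇒x≡𝟘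
              (proj₁ s-sup e (e≤𝟙' , e⨾x≡𝟘)) (≤-trans e≤𝟙'·-s (x·y≤y 𝟙' (- s)))))

module BelowComposite {ℓ} (𝔄 : REL ℓ) (perfect : Perfect 𝔄) {a b c : REL.A 𝔄}
  (a-atom : REL.IsAtom 𝔄 a) (a≤b⨾c : REL._≤_ 𝔄 a (REL._⨾_ 𝔄 b c)) where
  open REL 𝔄 renaming (_≤_ to infix 4 _≤_)
  open Properties 𝔄
  open PerfectProperties 𝔄 perfect
  open ≤-Reasoning

  b⨾c≢𝟘 : ¬ b ⨾ c ≡ 𝟘
  b⨾c≢𝟘 b⨾c≡𝟘 = proj₁ a-atom (x≤𝟘⇒x≡𝟘 (subst (a ≤_) b⨾c≡𝟘 a≤b⨾c))

  st-b≡𝟘⇒st-a≡𝟘 : st b ≡ 𝟘 → st a ≡ 𝟘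
  st-b≡𝟘⇒st-a≡𝟘 st-b≡𝟘 = x≤𝟘⇒x≡𝟘 (begin
    𝟙' ⨾ a          ≤⟨ ⨾-monoʳ-≤ 𝟙' a≤b⨾c ⟩
    𝟙' ⨾ (b ⨾ c)    ≡⟨ sym (subid⨾-assoc ≤-refl b c) ⟩
    (𝟙' ⨾ b) ⨾ c    ≡⟨ cong (_⨾ c) st-b≡𝟘 ⟩
    𝟘 ⨾ c           ≡⟨ ⨾-zeroˡ c ⟩
    𝟘               ∎)

  st-a≢𝟘⇔st-b≢𝟘 : IsAtom b → (¬ st a ≡ 𝟘) ⇔ (¬ st b ≡ 𝟘)
  st-a≢𝟘⇔st-b≢𝟘 b-atom = mk⇔ (λ st-a≢𝟘 → st-a≢𝟘 ∘′ st-b≡𝟘⇒st-a≡𝟘) st-b≢𝟘⇒st-a≢𝟘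
    where
      st-b≢𝟘⇒st-a≢𝟘 : ¬ st b ≡ 𝟘 → ¬ st a ≡ 𝟘
      st-b≢𝟘⇒st-a≢𝟘 st-b≢𝟘 st-a≡𝟘 = proj₁ a-atom (st≡𝟘⇒≤𝟙'⨾⇒≡𝟘 st-a≡𝟘 (begin
        a               ≤⟨ a≤b⨾c ⟩
        b ⨾ c           ≡⟨ cong (_⨾ c) (sym (st-atom b-atom st-b≢𝟘)) ⟩
        (𝟙' ⨾ b) ⨾ c    ≡⟨ subid⨾-assoc ≤-refl b c ⟩
        𝟙' ⨾ (b ⨾ c)    ∎))

  𝒮-unique : ∀ e e' → Is𝒮 a e → Is𝒮 b e' → e ≡ e'
  𝒮-unique e e' (e-atom , e≤𝟙' , e⨾a≡a) (e'-atom , e'≤𝟙' , e'⨾b≡b) =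
    atom-·≢𝟘⇒≡ e-atom e'-atom λ e·e'≡𝟘 → proj₁ a-atom (x≤𝟘⇒x≡𝟘 (begin
      a                      ≡⟨ sym e⨾a≡a ⟩
      e ⨾ a                  ≤⟨ ⨾-monoʳ-≤ e a≤b⨾c ⟩
      e ⨾ (b ⨾ c)            ≡⟨ cong (λ x → e ⨾ (x ⨾ c)) (sym e'⨾b≡b) ⟩
      e ⨾ ((e' ⨾ b) ⨾ c)     ≡⟨ cong (e ⨾_) (subid⨾-assoc e'≤𝟙' b c) ⟩
      e ⨾ (e' ⨾ (b ⨾ c))     ≡⟨ sym (subid⨾-assoc e≤𝟙' e' (b ⨾ c)) ⟩
      (e ⨾ e') ⨾ (b ⨾ c)     ≡⟨ cong (_⨾ (b ⨾ c)) (disjoint-subid⨾≡𝟘 e≤𝟙' e'≤𝟙' e·e'≡𝟘) ⟩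
      𝟘 ⨾ (b ⨾ c)            ≡⟨ ⨾-zeroˡ (b ⨾ c) ⟩
      𝟘                      ∎))

  same-𝒮 : IsAtom b → ¬ st a ≡ 𝟘 → ¬ st b ≡ 𝟘 → Same𝒮𝒮 𝔄 a b
  same-𝒮 b-atom st-a≢𝟘 st-b≢𝟘 =
    common-witness (𝒮-exists a-atom st-a≢𝟘) (𝒮-exists b-atom st-b≢𝟘) 𝒮-unique

  end-b≢𝟘⇒st-c≢𝟘 : IsAtom b → ¬ end b ≡ 𝟘 → ¬ st c ≡ 𝟘
  end-b≢𝟘⇒st-c≢𝟘 b-atom end-b≢𝟘 st-c≡𝟘 = b⨾c≢𝟘 (begin-equality
    b ⨾ c           ≡⟨ cong (_⨾ c) (sym (end-b≡b)) ⟩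
    (b ⨾ 𝟙') ⨾ c    ≡⟨ ⨾subid⨾-assoc ≤-refl b c ⟩
    b ⨾ (𝟙' ⨾ c)    ≡⟨ cong (b ⨾_) st-c≡𝟘 ⟩
    b ⨾ 𝟘           ≡⟨ ⨾-zeroʳ b ⟩
    𝟘               ∎)
    where end-b≡b = Properties.st-atom (𝔄 ᵒᵖ) b-atom end-b≢𝟘

  ℰ𝒮-unique : ∀ e e' → Isℰ b e → Is𝒮 c e' → e ≡ e'
  ℰ𝒮-unique e e' (e-atom , e≤𝟙' , b⨾e≡b) (e'-atom , e'≤𝟙' , e'⨾c≡c) =
    atom-·≢𝟘⇒≡ e-atom e'-atom λ e·e'≡𝟘 → b⨾c≢𝟘 (begin-equality
      b ⨾ c                  ≡⟨ sym (cong₂ _⨾_ b⨾e≡b e'⨾c≡c) ⟩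
      (b ⨾ e) ⨾ (e' ⨾ c)     ≡⟨ ⨾subid⨾-assoc e≤𝟙' b (e' ⨾ c) ⟩
      b ⨾ (e ⨾ (e' ⨾ c))     ≡⟨ cong (b ⨾_) (sym (subid⨾-assoc e≤𝟙' e' c)) ⟩
      b ⨾ ((e ⨾ e') ⨾ c)     ≡⟨ cong (λ x → b ⨾ (x ⨾ c)) (disjoint-subid⨾≡𝟘 e≤𝟙' e'≤𝟙' e·e'≡𝟘) ⟩
      b ⨾ (𝟘 ⨾ c)            ≡⟨ cong (b ⨾_) (⨾-zeroˡ c) ⟩
      b ⨾ 𝟘                  ≡⟨ ⨾-zeroʳ b ⟩
      𝟘                      ∎)

  same-ℰ𝒮 : IsAtom b → IsAtom c → ¬ end b ≡ 𝟘 → ¬ st c ≡ 𝟘 → Sameℰ𝒮 𝔄 b c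
  same-ℰ𝒮 b-atom c-atom end-b≢𝟘 st-c≢𝟘 =
    common-witness (PerfectProperties.𝒮-exists (𝔄 ᵒᵖ) (perfect-ᵒᵖ 𝔄 perfect) b-atom end-b≢𝟘)
                   (𝒮-exists c-atom st-c≢𝟘) ℰ𝒮-unique

open Defs using (IsAtom; st; end; _≤_; _⨾_; 𝟘)

lemma2p6 : ∀ {ℓ : Level} (𝔄 : REL ℓ) → Perfect 𝔄 →
    ∀ a b c → IsAtom 𝔄 a → IsAtom 𝔄 b → IsAtom 𝔄 c →
    _≤_ 𝔄 a (_⨾_ 𝔄 b c) →
    (((¬ (st 𝔄 a ≡ 𝟘 𝔄)) ⇔ (¬ (st 𝔄 b ≡ 𝟘 𝔄)))
      × (¬ (st 𝔄 a ≡ 𝟘 𝔄) → ¬ (st 𝔄 b ≡ 𝟘 𝔄) → Same𝒮𝒮 𝔄 a b))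
    × (((¬ (end 𝔄 a ≡ 𝟘 𝔄)) ⇔ (¬ (end 𝔄 c ≡ 𝟘 𝔄)))
      × (¬ (end 𝔄 a ≡ 𝟘 𝔄) → ¬ (end 𝔄 c ≡ 𝟘 𝔄) → Sameℰℰ 𝔄 a c))
    × (((¬ (end 𝔄 b ≡ 𝟘 𝔄)) ⇔ (¬ (st 𝔄 c ≡ 𝟘 𝔄)))
      × (¬ (end 𝔄 b ≡ 𝟘 𝔄) → ¬ (st 𝔄 c ≡ 𝟘 𝔄) → Sameℰ𝒮 𝔄 b c))
lemma2p6 𝔄 perfect a b c a-atom b-atom c-atom a≤b⨾c =
    (st-a≢𝟘⇔st-b≢𝟘 b-atom , same-𝒮 b-atom)
  , (Opposite.st-a≢𝟘⇔st-b≢𝟘 c-atom , Opposite.same-𝒮 c-atom)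
  , (mk⇔ (end-b≢𝟘⇒st-c≢𝟘 b-atom) (Opposite.end-b≢𝟘⇒st-c≢𝟘 c-atom) , same-ℰ𝒮 b-atom c-atom)
  where
    open BelowComposite 𝔄 perfect a-atom a≤b⨾c
    module Opposite = BelowComposite (𝔄 ᵒᵖ) (perfect-ᵒᵖ 𝔄 perfect) {a} {c} {b} a-atom a≤b⨾c
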